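{- Let $r$ be a positive integer, let $\epsilon\le 1/10$, and let $B'$ be an $[n]$-way branching program of height $q=\epsilon n$ on inputs $x\in[n]^{2n-1}$ that may produce outputs for positions of $F_0^{\boxplus n}$. Let $\pi$ be a path in $B'$ (from its source to a sink) and let $i_1<\cdots<i_r$ be $r$ $\pi$-unique positions at which $\pi$ produces output values $z_{i_1},\ldots,z_{i_r}$. For $x$ chosen uniformly from $[n]^{2n-1}$, \[\Pr\big[y_{i_1}=z_{i_1},\ldots,y_{i_r}=z_{i_r}\text{ and }\mathcal{E}\ \big|\ \pi_{B'}(x)=\pi\big]\le (17/18)^r,\] where $y_i=F_0(x_i,\ldots,x_{i+n-1})$ for $i\in[n]$ and $\mathcal{E}$ is the event that $0.5n\le y_i\le 0.85n$ for all $i\in[n]$.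
   Context: $F_0$ of a string is its number of distinct symbols; $F_0^{\boxplus n}(x)=(F_0(x_i\ldots x_{i+n-1}))_{i=1}^n$ for $x\in[n]^{2n-1}$. An $[n]$-way branching program is a DAG with a source and sinks, each non-sink node labeled by an input index, each edge labeled by a value in $[n]$ (the answer to the query) and possibly by output assignments (values assigned to output positions); its height is the length of its longest path. For a path $\pi$, $Q_\pi$ is the set of input indices queried along $\pi$ and $A_\pi:Q_\pi\to[n]$ the answers along $\pi$; $\pi_{B'}(x)$ denotes the path followed on input $x$, so $\pi_{B'}(x)=\pi$ iff $x_i=A_\pi(i)$ for all $i\in Q_\pi$. An index $\ell<n$ is $\pi$-unique iff either $\ell\notin Q_\pi$ or $A_\pi(\ell)\notin A_\pi(Q_\pi\setminus\{\ell\})$. -}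

module Defs where

open import Data.Bool using (Bool; true; false; _∧_; if_then_else_)
open import Data.Nat as ℕ using (ℕ; zero; suc; _+_; _*_; _∸_; _≤_; _<_; s≤s; z≤n)
open import Data.Nat.Properties using (+-suc; +-mono-≤; m≤m+n; ≤-trans; ≤-reflexive)
open import Data.Fin as Fin using (Fin; toℕ; fromℕ<)
open import Data.Fin.Properties using (toℕ<n)
open import Data.List as List using (List; []; _∷_; length; map; concatMap; allFin; deduplicate; foldr)
open import Data.List.Membership.Propositional using (_∈_)
open import Data.Vec.Functional as VF using (Vector)
open import Data.Product using (_×_; _,_)
open import Relation.Nullary using (¬_)
open import Relation.Nullary.Decidable using (⌊_⌋)
open import Relation.Binary.PropositionalEquality using (_≡_; _≢_; subst; sym)

-- Inputs: x ∈ [n]^(2n-1), with [n] = Fin n (0-based symbols) and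
-- input positions Fin (n + n ∸ 1) (0-based, so 0 … 2n-2).

InLen : ℕ → ℕ
InLen n = n + n ∸ 1

Input : ℕ → Set
Input n = Fin (InLen n) → Fin n

window-bound : ∀ {n i k} → i < n → k < n → suc (i + k) ≤ InLen n
window-bound {suc m} {i} {k} (s≤s i≤m) k<n =
  subst (_≤ m + suc m) (+-suc i k) (+-mono-≤ i≤m k<n)

winIdx : ∀ {n} → Fin n → Fin n → Fin (InLen n)
winIdx {n} i k = fromℕ< (window-bound (toℕ<n i) (toℕ<n k))

pos-bound : ∀ {n i} → i < n → i < InLen n
pos-bound {suc m} {i} (s≤s i≤m) =
  ≤-trans (s≤s (≤-trans i≤m (m≤m+n m m))) (≤-reflexive (sym (+-suc m m)))

posIdx : ∀ {n} → Fin n → Fin (InLen n)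
posIdx i = fromℕ< (pos-bound (toℕ<n i))

allᵇ : ∀ {A : Set} → (A → Bool) → List A → Bool
allᵇ p [] = true
allᵇ p (a ∷ as) = p a ∧ allᵇ p as

F₀ : ∀ {n} → List (Fin n) → ℕ
F₀ xs = length (deduplicate Fin._≟_ xs)

window : ∀ {n} → Input n → Fin n → List (Fin n)
window x i = map (λ k → x (winIdx i k)) (allFin _)

y : ∀ {n} → Input n → Fin n → ℕ
y x i = F₀ (window x i)

-- Paths in an [n]-way branching program on inputs of length 2n-1.
-- A root-to-sink path is the list of its edges; each edge records the
-- queried input index, the answer (edge label) and the output
-- assignments (position , value) made on that edge.

record Step (n : ℕ) : Set where
  constructor step
  field
    query   : Fin (InLen n)
    answer  : Fin n
    outputs : List (Fin n × ℕ)
open Step public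

Path : ℕ → Set
Path n = List (Step n)

Qπ : ∀ {n} → Path n → List (Fin (InLen n))
Qπ = map query

Outputs : ∀ {n} → Path n → List (Fin n × ℕ)
Outputs = concatMap outputs

-- ℓ is π-unique: ℓ ∉ Q_π, or A_π(ℓ) ∉ A_π(Q_π ∖ {ℓ})
PiUnique : ∀ {n} → Path n → Fin (InLen n) → Set
PiUnique π ℓ = ∀ s → s ∈ π → query s ≡ ℓ →
               ∀ s′ → s′ ∈ π → query s′ ≢ ℓ → answer s ≢ answer s′

-- π_{B'}(x) = π  iff  x_i = A_π(i) for all i ∈ Q_π
follows : ∀ {n} → Input n → Path n → Bool
follows x π = allᵇ (λ s → ⌊ x (query s) Fin.≟ answer s ⌋) π

matches : ∀ {n r} → Input n → Vector (Fin n) r → Vector ℕ r → Bool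
matches x is zs = allᵇ (λ k → ⌊ y x (is k) ℕ.≟ zs k ⌋) (allFin _)

eventE : ∀ {n} → Input n → Bool
eventE {n} x = allᵇ (λ i → ⌊ n ℕ.≤? 2 * y x i ⌋ ∧ ⌊ 20 * y x i ℕ.≤? 17 * n ⌋) (allFin n)

-- counting functions Fin m → Fin n satisfying a boolean predicate
-- (|{x ∈ [n]^m : P x}|; probabilities under the uniform distribution
-- are these counts divided by n^m)

sumFin : ∀ n → (Fin n → ℕ) → ℕ
sumFin zero f = 0
sumFin (suc n) f = f Fin.zero + sumFin n (λ i → f (Fin.suc i))

count : ∀ m n → ((Fin m → Fin n) → Bool) → ℕ
count zero n P = if P (λ ()) then 1 else 0
count (suc m) n P = sumFin n (λ a → count m n (λ f → P (a VF.∷ f)))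

module Submission where

-- Peel the outputs off from left to right. For the leftmost position ℓ, condition on π and on
-- the later outputs y_j (j > ℓ), which only read inputs after ℓ. If π does not query ℓ,
-- re-draw x_ℓ uniformly; if it does, with answer a, swap the symbols a and b at every
-- position after ℓ, for b uniform among the at least 0.9n symbols that are not answers of
-- other queries (π-uniqueness says a is not one either). Both moves preserve π and the later
-- outputs, and turn y_ℓ into F₀ (b ∷ R) for the fixed rest R of the window. That equals F₀ R
-- for the F₀ R symbols b ∈ R and F₀ R + 1 for the others, so a value z ∈ [n/2, 17n/20] is hit
-- by at most max(z, n + 1 − z) ≤ (17/18)·0.9n of the choices of b.

open import Defs
open import Data.Nat.Properties
open import Algebra.Properties.CommutativeMonoid.Sum Data.Nat.Properties.+-0-commutativeMonoid
  using (sum; sum-syntax; sum-cong-≗; sum-permute; ∑-comm; ∑-distrib-+; sum-replicate-zero)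
open import Algebra.Properties.Semiring.Sum Data.Nat.Properties.+-*-semiring
  using (*-distribˡ-sum; *-distribʳ-sum)
open import Data.Bool using (Bool; true; false; _∧_; _∨_; not; if_then_else_)
open import Data.Bool.Properties using (∧-assoc; ∧-comm; ∧-identityʳ; ∧-conicalˡ; ∧-conicalʳ)
open import Data.Fin as Fin using (Fin; toℕ)
import Data.Fin.Properties as Finₚ
open import Data.Fin.Permutation as Perm using (Permutation′; _⟨$⟩ʳ_; _⟨$⟩ˡ_)
import Data.Fin.Permutation.Components as PC
open import Data.Nat as ℕ using (ℕ; zero; suc; _+_; _*_; _^_; _≤_; _<_; z≤n; s≤s; >-nonZero)
open import Data.Vec.Functional as Vec using (Vector; updateAt)
open import Data.Vec.Functional.Properties using (updateAt-updates; updateAt-minimal)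
open import Data.List using (List; []; _∷_; length; map; filter; tabulate; allFin)
import Data.List.Properties as Listₚ
open import Data.List.Membership.Propositional using (_∈_; find; lose)
import Data.List.Membership.DecPropositional as DecMembership
open import Data.List.Membership.Propositional.Properties
  using (∈-map⁺; ∈-map⁻; ∈-filter⁺; ∈-allFin; ∈-deduplicate⁺; ∈-deduplicate⁻)
open import Data.List.Relation.Unary.All.Properties using (All¬⇒¬Any)
open import Data.List.Relation.Unary.Any using (here; there; any?)
open import Data.List.Relation.Unary.AllPairs using ([]; _∷_)
open import Data.List.Relation.Unary.Unique.Propositional using (Unique)
open import Data.List.Relation.Unary.Unique.DecPropositional.Properties using (deduplicate-!)
open import Data.Product using (_×_; _,_; proj₁; proj₂)
open import Data.Sum using (_⊎_; inj₁; inj₂)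
open import Function using (_∘_; const; _⇔_; mk⇔)
open import Relation.Binary.Core using (_Preserves_⟶_)
open import Relation.Binary.PropositionalEquality
open import Relation.Nullary using (¬_; ¬?; Dec; does; yes; no; _×-dec_; contradiction)
open import Relation.Nullary.Decidable using (⌊_⌋; isYes≗does; does-⇔; dec-true; dec-false)
open import Data.Nat.Tactic.RingSolver using (solve-∀)

-- Indicators and finite sums

-- Defined by `if` so that `count` unfolds to a `total` of indicators.
𝟙 : Bool → ℕ
𝟙 b = if b then 1 else 0

𝟙≤1 : ∀ b → 𝟙 b ≤ 1
𝟙≤1 true = s≤s z≤n
𝟙≤1 false = z≤n

𝟙-∧ : ∀ a b → 𝟙 (a ∧ b) ≡ 𝟙 a * 𝟙 b
𝟙-∧ true b = sym (+-identityʳ (𝟙 b))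
𝟙-∧ false b = refl

𝟙-+-not : ∀ b → 𝟙 b + 𝟙 (not b) ≡ 1
𝟙-+-not true = refl
𝟙-+-not false = refl

𝟙-∨ : ∀ a b → 𝟙 (a ∨ b) ≡ 𝟙 b + 𝟙 a * 𝟙 (not b)
𝟙-∨ true true = refl
𝟙-∨ true false = refl
𝟙-∨ false b = sym (+-identityʳ (𝟙 b))

𝟙-mono : ∀ {a b} → (a ≡ true → b ≡ true) → 𝟙 a ≤ 𝟙 b
𝟙-mono {false} _ = z≤n
𝟙-mono {true} a⇒b rewrite a⇒b refl = ≤-refl

sumFin≡sum : ∀ n (f : Fin n → ℕ) → sumFin n f ≡ sum f
sumFin≡sum zero f = refl
sumFin≡sum (suc n) f = cong (f Fin.zero +_) (sumFin≡sum n (f ∘ Fin.suc))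

sum-mono-≤ : ∀ {n} {f g : Fin n → ℕ} → (∀ i → f i ≤ g i) → sum f ≤ sum g
sum-mono-≤ {zero} f≤g = z≤n
sum-mono-≤ {suc n} f≤g = +-mono-≤ (f≤g Fin.zero) (sum-mono-≤ (f≤g ∘ Fin.suc))

sum-const : ∀ n c → sum {n} (const c) ≡ n * c
sum-const zero c = refl
sum-const (suc n) c = cong (c +_) (sum-const n c)

sum-𝟙-≡ : ∀ {n} (b : Fin n) (g : Fin n → ℕ) → ∑[ c < n ] (𝟙 (does (c Finₚ.≟ b)) * g c) ≡ g b
sum-𝟙-≡ {suc n} Fin.zero g = begin
  g Fin.zero + 0 + ∑[ c < n ] (0 * g (Fin.suc c)) ≡⟨ cong₂ _+_ (+-identityʳ _) (sum-replicate-zero n) ⟩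
  g Fin.zero + 0                                 ≡⟨ +-identityʳ _ ⟩
  g Fin.zero                                     ∎
  where open ≡-Reasoning
sum-𝟙-≡ {suc n} (Fin.suc b) g = begin
  ∑[ c < n ] (𝟙 (does (Fin.suc c Finₚ.≟ Fin.suc b)) * g (Fin.suc c))
    ≡⟨ sum-cong-≗ (λ c → cong (λ t → 𝟙 t * g (Fin.suc c)) (suc-≟ c)) ⟩
  ∑[ c < n ] (𝟙 (does (c Finₚ.≟ b)) * g (Fin.suc c))
    ≡⟨ sum-𝟙-≡ b (g ∘ Fin.suc) ⟩
  g (Fin.suc b) ∎
  where
  open ≡-Reasoning
  suc-≟ : ∀ c → does (Fin.suc c Finₚ.≟ Fin.suc b) ≡ does (c Finₚ.≟ b)
  suc-≟ c with c Finₚ.≟ b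
  ... | yes _ = refl
  ... | no _ = refl

sum-𝟙+sum-𝟙-not : ∀ {n} (c : Fin n → Bool) → ∑[ b < n ] 𝟙 (c b) + ∑[ b < n ] 𝟙 (not (c b)) ≡ n
sum-𝟙+sum-𝟙-not {n} c = begin
  ∑[ b < n ] 𝟙 (c b) + ∑[ b < n ] 𝟙 (not (c b))
    ≡⟨ ∑-distrib-+ (λ b → 𝟙 (c b)) (λ b → 𝟙 (not (c b))) ⟨
  ∑[ b < n ] (𝟙 (c b) + 𝟙 (not (c b)))
    ≡⟨ sum-cong-≗ (λ b → 𝟙-+-not (c b)) ⟩
  ∑[ b < n ] 1 ≡⟨ sum-const n 1 ⟩
  n * 1        ≡⟨ *-identityʳ n ⟩
  n            ∎
  where open ≡-Reasoning

-- Counting functions Fin m → Fin n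

total : ∀ m n → ((Fin m → Fin n) → ℕ) → ℕ
total zero n W = W (λ ())
total (suc m) n W = ∑[ a < n ] total m n (λ f → W (a Vec.∷ f))

count≡total : ∀ m n (P : (Fin m → Fin n) → Bool) → count m n P ≡ total m n (𝟙 ∘ P)
count≡total zero n P = refl
count≡total (suc m) n P =
  trans (sumFin≡sum n _) (sum-cong-≗ (λ a → count≡total m n (λ f → P (a Vec.∷ f))))

total-cong : ∀ m n {V W : (Fin m → Fin n) → ℕ} → (∀ f → V f ≡ W f) → total m n V ≡ total m n W
total-cong zero n V≗W = V≗W _
total-cong (suc m) n V≗W = sum-cong-≗ (λ a → total-cong m n (λ f → V≗W (a Vec.∷ f)))

count-cong : ∀ m n {P Q : (Fin m → Fin n) → Bool} → (∀ f → P f ≡ Q f) → count m n P ≡ count m n Q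
count-cong m n {P} {Q} P≡Q = begin
  count m n P       ≡⟨ count≡total m n P ⟩
  total m n (𝟙 ∘ P) ≡⟨ total-cong m n (cong 𝟙 ∘ P≡Q) ⟩
  total m n (𝟙 ∘ Q) ≡⟨ count≡total m n Q ⟨
  count m n Q       ∎
  where open ≡-Reasoning

total-mono : ∀ m n {V W : (Fin m → Fin n) → ℕ} → (∀ f → V f ≤ W f) → total m n V ≤ total m n W
total-mono zero n V≤W = V≤W _
total-mono (suc m) n V≤W = sum-mono-≤ (λ a → total-mono m n (λ f → V≤W (a Vec.∷ f)))

count-mono : ∀ m n {P Q : (Fin m → Fin n) → Bool} → (∀ f → P f ≡ true → Q f ≡ true) →
             count m n P ≤ count m n Q
count-mono m n {P} {Q} P⇒Q = subst₂ _≤_ (sym (count≡total m n P)) (sym (count≡total m n Q))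
  (total-mono m n λ f → 𝟙-mono (P⇒Q f))

total-zero : ∀ m n → total m n (const 0) ≡ 0
total-zero zero n = refl
total-zero (suc m) n = trans (sum-cong-≗ {n} (λ a → total-zero m n)) (sum-replicate-zero n)

total-*ˡ : ∀ m n c (W : (Fin m → Fin n) → ℕ) → total m n (λ f → c * W f) ≡ c * total m n W
total-*ˡ zero n c W = refl
total-*ˡ (suc m) n c W =
  trans (sum-cong-≗ (λ a → total-*ˡ m n c (λ f → W (a Vec.∷ f))))
        (sym (*-distribˡ-sum c (λ a → total m n (λ f → W (a Vec.∷ f)))))

total-sum : ∀ m n {k} (W : Fin k → (Fin m → Fin n) → ℕ) →
            ∑[ b < k ] total m n (W b) ≡ total m n (λ f → ∑[ b < k ] W b f)
total-sum zero n W = refl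
total-sum (suc m) n W = trans (∑-comm (λ b a → total m n (λ f → W b (a Vec.∷ f))))
                              (sum-cong-≗ (λ a → total-sum m n (λ b f → W b (a Vec.∷ f))))

Invariant : ∀ {m n} {B : Set} → ((Fin m → Fin n) → B) → Set
Invariant W = W Preserves _≗_ ⟶ _≡_

∷-Invariant : ∀ {m n} {B : Set} {W : (Fin (suc m) → Fin n) → B} →
              Invariant W → ∀ a → Invariant (λ f → W (a Vec.∷ f))
∷-Invariant W-inv a f≗g = W-inv λ { Fin.zero → refl ; (Fin.suc i) → f≗g i }

total-update : ∀ m n (ℓ : Fin m) {W : (Fin m → Fin n) → ℕ} → Invariant W →
               ∑[ c < n ] total m n (λ f → W (updateAt f ℓ (const c))) ≡ n * total m n W
total-update (suc m) n Fin.zero {W} W-inv = begin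
  ∑[ c < n ] ∑[ a < n ] total m n (λ f → W (updateAt (a Vec.∷ f) Fin.zero (const c)))
    ≡⟨ sum-cong-≗ (λ c → sum-cong-≗ (λ a → total-cong m n (λ f → W-inv (reset c a f)))) ⟩
  ∑[ c < n ] ∑[ _ < n ] total m n (λ f → W (c Vec.∷ f))
    ≡⟨ sum-cong-≗ (λ c → sum-const n (total m n (λ f → W (c Vec.∷ f)))) ⟩
  ∑[ c < n ] (n * total m n (λ f → W (c Vec.∷ f)))
    ≡⟨ *-distribˡ-sum n (λ c → total m n (λ f → W (c Vec.∷ f))) ⟨
  n * total (suc m) n W ∎
  where
  open ≡-Reasoning
  reset : ∀ c a f → updateAt (a Vec.∷ f) Fin.zero (const c) ≗ c Vec.∷ f
  reset c a f Fin.zero = refl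
  reset c a f (Fin.suc i) = refl
total-update (suc m) n (Fin.suc ℓ) {W} W-inv = begin
  ∑[ c < n ] ∑[ a < n ] total m n (λ f → W (updateAt (a Vec.∷ f) (Fin.suc ℓ) (const c)))
    ≡⟨ sum-cong-≗ (λ c → sum-cong-≗ (λ a → total-cong m n (λ f → W-inv (commute c a f)))) ⟩
  ∑[ c < n ] ∑[ a < n ] total m n (λ f → W (a Vec.∷ updateAt f ℓ (const c)))
    ≡⟨ ∑-comm (λ c a → total m n (λ f → W (a Vec.∷ updateAt f ℓ (const c)))) ⟩
  ∑[ a < n ] ∑[ c < n ] total m n (λ f → W (a Vec.∷ updateAt f ℓ (const c)))
    ≡⟨ sum-cong-≗ (λ a → total-update m n ℓ (∷-Invariant W-inv a)) ⟩
  ∑[ a < n ] (n * total m n (λ f → W (a Vec.∷ f)))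
    ≡⟨ *-distribˡ-sum n (λ c → total m n (λ f → W (c Vec.∷ f))) ⟨
  n * total (suc m) n W ∎
  where
  open ≡-Reasoning
  commute : ∀ c a f → updateAt (a Vec.∷ f) (Fin.suc ℓ) (const c) ≗ a Vec.∷ updateAt f ℓ (const c)
  commute c a f Fin.zero = refl
  commute c a f (Fin.suc i) = refl

total-permute : ∀ m n (σ : Fin m → Permutation′ n) {W : (Fin m → Fin n) → ℕ} → Invariant W →
                total m n (λ f → W (λ p → σ p ⟨$⟩ʳ f p)) ≡ total m n W
total-permute zero n σ W-inv = W-inv (λ ())
total-permute (suc m) n σ {W} W-inv = begin
  ∑[ a < n ] total m n (λ f → W (λ p → σ p ⟨$⟩ʳ (a Vec.∷ f) p)) 
    ≡⟨ sum-cong-≗ (λ a → total-cong m n (λ f → W-inv (push a f))) ⟩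
  ∑[ a < n ] total m n (λ f → W ((σ Fin.zero ⟨$⟩ʳ a) Vec.∷ (λ p → σ (Fin.suc p) ⟨$⟩ʳ f p)))
    ≡⟨ sum-cong-≗ (λ a → total-permute m n (σ ∘ Fin.suc) (∷-Invariant W-inv (σ Fin.zero ⟨$⟩ʳ a))) ⟩
  ∑[ a < n ] total m n (λ f → W ((σ Fin.zero ⟨$⟩ʳ a) Vec.∷ f))
    ≡⟨ sum-permute (λ c → total m n (λ f → W (c Vec.∷ f))) (σ Fin.zero) ⟨
  total (suc m) n W ∎
  where
  open ≡-Reasoning
  push : ∀ a f → (λ p → σ p ⟨$⟩ʳ (a Vec.∷ f) p) ≗
                 (σ Fin.zero ⟨$⟩ʳ a) Vec.∷ (λ p → σ (Fin.suc p) ⟨$⟩ʳ f p)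
  push a f Fin.zero = refl
  push a f (Fin.suc p) = refl

-- Double counting over pairs (b, x): the β-weighted images γ b x cover every input ∑ β times.
averaging : ∀ {m n} (c d : ℕ) (G A : (Fin m → Fin n) → Bool)
  (γ : Fin n → (Fin m → Fin n) → (Fin m → Fin n)) (β : Fin n → ℕ) → 0 < sum β →
  (∀ {W} → Invariant W → ∑[ b < n ] (β b * total m n (W ∘ γ b)) ≡ sum β * total m n W) →
  Invariant G → Invariant A →
  (∀ b x → β b * 𝟙 (G (γ b x)) ≡ β b * 𝟙 (G x)) →
  (∀ x → G x ≡ true → d * ∑[ b < n ] (β b * 𝟙 (A (γ b x))) ≤ c * sum β) →
  d * count m n (λ x → G x ∧ A x) ≤ c * count m n G
averaging {m} {n} c d G A γ β β-pos average G-inv A-inv G-preserved bound =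
  subst₂ (λ s t → d * s ≤ c * t) (sym (count≡total m n _)) (sym (count≡total m n G))
    (*-cancelˡ-≤ M {{>-nonZero β-pos}} (begin
      M * (d * total m n (𝟙 ∘ GA))              ≡⟨ swap M d _ ⟩
      d * (M * total m n (𝟙 ∘ GA))              ≡⟨ cong (d *_) (average GA-inv) ⟨
      d * ∑[ b < n ] (β b * total m n (𝟙 ∘ GA ∘ γ b))
        ≡⟨ cong (d *_) (sum-cong-≗ (λ b → total-*ˡ m n (β b) (𝟙 ∘ GA ∘ γ b))) ⟨
      d * ∑[ b < n ] total m n (λ x → β b * 𝟙 (GA (γ b x)))
        ≡⟨ cong (d *_) (total-sum m n (λ b x → β b * 𝟙 (GA (γ b x)))) ⟩
      d * total m n (λ x → ∑[ b < n ] (β b * 𝟙 (GA (γ b x))))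
        ≡⟨ cong (d *_) (total-cong m n factor) ⟩
      d * total m n (λ x → 𝟙 (G x) * S x)       ≡⟨ total-*ˡ m n d _ ⟨
      total m n (λ x → d * (𝟙 (G x) * S x))     ≤⟨ total-mono m n pointwise ⟩
      total m n (λ x → c * M * 𝟙 (G x))         ≡⟨ total-*ˡ m n (c * M) (𝟙 ∘ G) ⟩
      c * M * total m n (𝟙 ∘ G)                 ≡⟨ *-assoc c M _ ⟩
      c * (M * total m n (𝟙 ∘ G))               ≡⟨ swap c M _ ⟩
      M * (c * total m n (𝟙 ∘ G))               ∎))
  where
  open ≤-Reasoning
  M = sum β
  GA : (Fin m → Fin n) → Bool
  GA x = G x ∧ A x
  S : (Fin m → Fin n) → ℕ
  S x = ∑[ b < n ] (β b * 𝟙 (A (γ b x)))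
  swap : ∀ a b c → a * (b * c) ≡ b * (a * c)
  swap = solve-∀
  GA-inv : Invariant (𝟙 ∘ GA)
  GA-inv f≗g = cong 𝟙 (cong₂ _∧_ (G-inv f≗g) (A-inv f≗g))
  factor : ∀ x → ∑[ b < n ] (β b * 𝟙 (GA (γ b x))) ≡ 𝟙 (G x) * S x
  factor x = begin-equality
    ∑[ b < n ] (β b * 𝟙 (GA (γ b x)))
      ≡⟨ sum-cong-≗ (λ b → cong (β b *_) (𝟙-∧ (G (γ b x)) (A (γ b x)))) ⟩
    ∑[ b < n ] (β b * (𝟙 (G (γ b x)) * 𝟙 (A (γ b x))))
      ≡⟨ sum-cong-≗ (λ b → move (β b) _ _ _ (G-preserved b x)) ⟩
    ∑[ b < n ] (𝟙 (G x) * (β b * 𝟙 (A (γ b x))))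
      ≡⟨ *-distribˡ-sum (𝟙 (G x)) (λ b → β b * 𝟙 (A (γ b x))) ⟨
    𝟙 (G x) * S x ∎
    where
    move : ∀ u v w t → u * v ≡ u * w → u * (v * t) ≡ w * (u * t)
    move u v w t uv≡uw = begin-equality
      u * (v * t) ≡⟨ *-assoc u v t ⟨
      u * v * t   ≡⟨ cong (_* t) uv≡uw ⟩
      u * w * t   ≡⟨ cong (_* t) (*-comm u w) ⟩
      w * u * t   ≡⟨ *-assoc w u t ⟩
      w * (u * t) ∎
  pointwise : ∀ x → d * (𝟙 (G x) * S x) ≤ c * M * 𝟙 (G x)
  pointwise x with G x in Gx
  ... | true = begin
    d * (S x + 0) ≡⟨ cong (d *_) (+-identityʳ (S x)) ⟩
    d * S x       ≤⟨ bound x Gx ⟩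
    c * M         ≡⟨ *-identityʳ (c * M) ⟨
    c * M * 1     ∎
  ... | false = begin
    d * 0         ≡⟨ *-zeroʳ d ⟩
    0             ≤⟨ z≤n ⟩
    c * M * 0     ∎

-- Distinct symbols

infix 4 _∈?_ _∉?_

_∈?_ : ∀ {n} (c : Fin n) (xs : List (Fin n)) → Dec (c ∈ xs)
_∈?_ = DecMembership._∈?_ Finₚ._≟_

_∉?_ : ∀ {n} (c : Fin n) (xs : List (Fin n)) → Dec (¬ c ∈ xs)
_∉?_ = DecMembership._∉?_ Finₚ._≟_

#symbols : ∀ {n} → List (Fin n) → ℕ
#symbols {n} xs = ∑[ c < n ] 𝟙 (does (c ∈? xs))

#symbols-cong : ∀ {n} {xs ys : List (Fin n)} → (∀ {c} → c ∈ xs ⇔ c ∈ ys) → #symbols xs ≡ #symbols ys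
#symbols-cong {n} {xs} {ys} xs⇔ys = sum-cong-≗ (λ c → cong 𝟙 (does-⇔ xs⇔ys (c ∈? xs) (c ∈? ys)))

#symbols-cons : ∀ {n} (b : Fin n) xs → #symbols (b ∷ xs) ≡ #symbols xs + 𝟙 (does (b ∉? xs))
#symbols-cons {n} b xs = begin
  ∑[ c < n ] 𝟙 (does (c Finₚ.≟ b) ∨ does (c ∈? xs))
    ≡⟨ sum-cong-≗ (λ c → 𝟙-∨ (does (c Finₚ.≟ b)) (does (c ∈? xs))) ⟩
  ∑[ c < n ] (𝟙 (does (c ∈? xs)) + 𝟙 (does (c Finₚ.≟ b)) * 𝟙 (does (c ∉? xs)))
    ≡⟨ ∑-distrib-+ (λ c → 𝟙 (does (c ∈? xs)))
                   (λ c → 𝟙 (does (c Finₚ.≟ b)) * 𝟙 (does (c ∉? xs))) ⟩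
  #symbols xs + ∑[ c < n ] (𝟙 (does (c Finₚ.≟ b)) * 𝟙 (does (c ∉? xs)))
    ≡⟨ cong (#symbols xs +_) (sum-𝟙-≡ b (λ c → 𝟙 (does (c ∉? xs)))) ⟩
  #symbols xs + 𝟙 (does (b ∉? xs)) ∎
  where open ≡-Reasoning

length≡#symbols : ∀ {n} {xs : List (Fin n)} → Unique xs → length xs ≡ #symbols xs
length≡#symbols {n} {[]} [] = sym (sum-replicate-zero n)
length≡#symbols {n} {b ∷ xs} (b∉xs ∷ xs!) = begin
  suc (length xs)                  ≡⟨ cong suc (length≡#symbols xs!) ⟩
  suc (#symbols xs)                ≡⟨ +-comm 1 (#symbols xs) ⟩
  #symbols xs + 1                  ≡⟨ cong (λ t → #symbols xs + 𝟙 t) (dec-true (b ∉? xs) (All¬⇒¬Any b∉xs)) ⟨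
  #symbols xs + 𝟙 (does (b ∉? xs)) ≡⟨ #symbols-cons b xs ⟨
  #symbols (b ∷ xs)                ∎
  where open ≡-Reasoning

F₀≡#symbols : ∀ {n} (xs : List (Fin n)) → F₀ xs ≡ #symbols xs
F₀≡#symbols xs = trans (length≡#symbols (deduplicate-! Finₚ._≟_ xs))
  (#symbols-cong (mk⇔ (∈-deduplicate⁻ Finₚ._≟_ xs) (∈-deduplicate⁺ Finₚ._≟_)))

F₀-cons : ∀ {n} (b : Fin n) xs → F₀ (b ∷ xs) ≡ F₀ xs + 𝟙 (does (b ∉? xs))
F₀-cons b xs = begin
  F₀ (b ∷ xs)                      ≡⟨ F₀≡#symbols (b ∷ xs) ⟩
  #symbols (b ∷ xs)                ≡⟨ #symbols-cons b xs ⟩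
  #symbols xs + 𝟙 (does (b ∉? xs)) ≡⟨ cong (_+ 𝟙 (does (b ∉? xs))) (F₀≡#symbols xs) ⟨
  F₀ xs + 𝟙 (does (b ∉? xs))       ∎
  where open ≡-Reasoning

F₀-map-permutation : ∀ {n} (σ : Permutation′ n) xs → F₀ (map (σ ⟨$⟩ʳ_) xs) ≡ F₀ xs
F₀-map-permutation {n} σ xs = begin
  F₀ (map (σ ⟨$⟩ʳ_) xs)                   ≡⟨ F₀≡#symbols (map (σ ⟨$⟩ʳ_) xs) ⟩
  ∑[ c < n ] 𝟙 (does (c ∈? map (σ ⟨$⟩ʳ_) xs))
    ≡⟨ sum-cong-≗ (λ c → cong 𝟙 (does-⇔ (mk⇔ (to c) (from c)) (c ∈? _) (σ ⟨$⟩ˡ c ∈? xs))) ⟩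
  ∑[ c < n ] 𝟙 (does (σ ⟨$⟩ˡ c ∈? xs))    ≡⟨ sum-permute (λ c → 𝟙 (does (c ∈? xs))) (Perm.flip σ) ⟨
  #symbols xs                              ≡⟨ F₀≡#symbols xs ⟨
  F₀ xs                                    ∎
  where
  open ≡-Reasoning
  to : ∀ c → c ∈ map (σ ⟨$⟩ʳ_) xs → σ ⟨$⟩ˡ c ∈ xs
  to c c∈σxs with ∈-map⁻ (σ ⟨$⟩ʳ_) c∈σxs
  ... | a , a∈xs , refl = subst (_∈ xs) (sym (Perm.inverseˡ σ)) a∈xs
  from : ∀ c → σ ⟨$⟩ˡ c ∈ xs → c ∈ map (σ ⟨$⟩ʳ_) xs
  from c σ⁻¹c∈xs = subst (_∈ map (σ ⟨$⟩ʳ_) xs) (Perm.inverseʳ σ) (∈-map⁺ (σ ⟨$⟩ʳ_) σ⁻¹c∈xs)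

-- D + [¬ c b] = z for the D symbols with c b if z = D, for the other n − D if z = 1 + D, else for none
#hits-bound : ∀ {n} (c : Fin n → Bool) z →
  let D = ∑[ b < n ] 𝟙 (c b); h = ∑[ b < n ] 𝟙 ⌊ D + 𝟙 (not (c b)) ℕ.≟ z ⌋ in h ≤ z ⊎ h + z ≤ suc n
#hits-bound {n} c z with z ℕ.≟ ∑[ b < n ] 𝟙 (c b) | z ℕ.≟ suc (∑[ b < n ] 𝟙 (c b))
... | yes refl | _ = inj₁ (≤-reflexive (sum-cong-≗ (λ b → at-D (c b))))
  where
  at-D : ∀ e → 𝟙 ⌊ z + 𝟙 (not e) ℕ.≟ z ⌋ ≡ 𝟙 e
  at-D true with z + 0 ℕ.≟ z
  ... | yes _ = refl
  ... | no z+0≢z = contradiction (+-identityʳ z) z+0≢z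
  at-D false with z + 1 ℕ.≟ z
  ... | yes z+1≡z = contradiction (trans (+-comm 1 z) z+1≡z) 1+n≢n
  ... | no _ = refl
... | no _ | yes refl = inj₂ (≤-reflexive (begin
  ∑[ b < n ] 𝟙 ⌊ D + 𝟙 (not (c b)) ℕ.≟ suc D ⌋ + suc D
    ≡⟨ cong (_+ suc D) (sum-cong-≗ (λ b → at-1+D (c b))) ⟩
  ∑[ b < n ] 𝟙 (not (c b)) + suc D                     ≡⟨ +-suc _ D ⟩
  suc (∑[ b < n ] 𝟙 (not (c b)) + D)                   ≡⟨ cong suc (+-comm _ D) ⟩
  suc (D + ∑[ b < n ] 𝟙 (not (c b)))                   ≡⟨ cong suc (sum-𝟙+sum-𝟙-not c) ⟩
  suc n                                                ∎))
  where
  open ≡-Reasoning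
  D = ∑[ b < n ] 𝟙 (c b)
  at-1+D : ∀ e → 𝟙 ⌊ D + 𝟙 (not e) ℕ.≟ suc D ⌋ ≡ 𝟙 (not e)
  at-1+D true with D + 0 ℕ.≟ suc D
  ... | yes D+0≡1+D = contradiction (trans (sym (+-identityʳ D)) D+0≡1+D) (1+n≢n ∘ sym)
  ... | no _ = refl
  at-1+D false with D + 1 ℕ.≟ suc D
  ... | yes _ = refl
  ... | no D+1≢1+D = contradiction (+-comm D 1) D+1≢1+D
... | no z≢D | no z≢1+D =
  inj₁ (≤-trans (≤-reflexive (trans (sum-cong-≗ (λ b → elsewhere (c b))) (sum-replicate-zero n))) z≤n)
  where
  D = ∑[ b < n ] 𝟙 (c b)
  elsewhere : ∀ e → 𝟙 ⌊ D + 𝟙 (not e) ℕ.≟ z ⌋ ≡ 0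
  elsewhere e with D + 𝟙 (not e) ℕ.≟ z
  ... | no _ = refl
  elsewhere true | yes D+0≡z = contradiction (trans (sym D+0≡z) (+-identityʳ D)) z≢D
  elsewhere false | yes D+1≡z = contradiction (trans (sym D+1≡z) (+-comm D 1)) z≢1+D

#extensions : ∀ {n} → List (Fin n) → ℕ → ℕ
#extensions {n} R z = ∑[ b < n ] 𝟙 ⌊ F₀ (b ∷ R) ℕ.≟ z ⌋

#extensions-bound : ∀ {n} (R : List (Fin n)) z → #extensions R z ≤ z ⊎ #extensions R z + z ≤ suc n
#extensions-bound {n} R z =
  subst (λ h → h ≤ z ⊎ h + z ≤ suc n) (sym #extensions≡) (#hits-bound (λ b → does (b ∈? R)) z)
  where
  #extensions≡ : #extensions R z ≡ ∑[ b < n ] 𝟙 ⌊ #symbols R + 𝟙 (does (b ∉? R)) ℕ.≟ z ⌋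
  #extensions≡ = sum-cong-≗ λ b → cong (λ t → 𝟙 ⌊ t ℕ.≟ z ⌋)
    (trans (F₀-cons b R) (cong (_+ 𝟙 (does (b ∉? R))) (F₀≡#symbols R)))

18h≤17m : ∀ {n m z h} → 3 ≤ n → 9 * n ≤ 10 * m → n ≤ 2 * z → 20 * z ≤ 17 * n →
          h ≤ z ⊎ h + z ≤ suc n → 18 * h ≤ 17 * m
18h≤17m {n} {m} {z} {h} _ 9n≤10m _ 20z≤17n (inj₁ h≤z) = *-cancelˡ-≤ 20 (begin
  20 * (18 * h) ≤⟨ *-monoʳ-≤ 20 (*-monoʳ-≤ 18 h≤z) ⟩
  20 * (18 * z) ≡⟨ e₁ z ⟩
  18 * (20 * z) ≤⟨ *-monoʳ-≤ 18 20z≤17n ⟩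
  18 * (17 * n) ≡⟨ e₂ n ⟩
  34 * (9 * n)  ≤⟨ *-monoʳ-≤ 34 9n≤10m ⟩
  34 * (10 * m) ≡⟨ e₃ m ⟩
  20 * (17 * m) ∎)
  where
  open ≤-Reasoning
  e₁ : ∀ z → 20 * (18 * z) ≡ 18 * (20 * z)
  e₁ = solve-∀
  e₂ : ∀ n → 18 * (17 * n) ≡ 34 * (9 * n)
  e₂ = solve-∀
  e₃ : ∀ m → 34 * (10 * m) ≡ 20 * (17 * m)
  e₃ = solve-∀
18h≤17m {n} {m} {z} {h} 3≤n 9n≤10m n≤2z _ (inj₂ h+z≤1+n) = *-cancelˡ-≤ 10 (begin
  10 * (18 * h)   ≡⟨ e₁ h ⟩
  90 * (2 * h)    ≤⟨ *-monoʳ-≤ 90 2h≤n+2 ⟩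
  90 * (n + 2)    ≡⟨ e₂ n ⟩
  90 * n + 60 * 3 ≤⟨ +-monoʳ-≤ (90 * n) (*-monoʳ-≤ 60 3≤n) ⟩
  90 * n + 60 * n ≤⟨ +-monoʳ-≤ (90 * n) (*-monoˡ-≤ n (m≤m+n 60 3)) ⟩
  90 * n + 63 * n ≡⟨ e₃ n ⟩
  17 * (9 * n)    ≤⟨ *-monoʳ-≤ 17 9n≤10m ⟩
  17 * (10 * m)   ≡⟨ e₄ m ⟩
  10 * (17 * m)   ∎)
  where
  open ≤-Reasoning
  e₁ : ∀ h → 10 * (18 * h) ≡ 90 * (2 * h)
  e₁ = solve-∀
  e₂ : ∀ n → 90 * (n + 2) ≡ 90 * n + 60 * 3
  e₂ = solve-∀
  e₃ : ∀ n → 90 * n + 63 * n ≡ 17 * (9 * n)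
  e₃ = solve-∀
  e₄ : ∀ m → 17 * (10 * m) ≡ 10 * (17 * m)
  e₄ = solve-∀
  2h≤n+2 : 2 * h ≤ n + 2
  2h≤n+2 = +-cancelʳ-≤ n (2 * h) (n + 2) (begin
    2 * h + n       ≤⟨ +-monoʳ-≤ (2 * h) n≤2z ⟩
    2 * h + 2 * z   ≡⟨ *-distribˡ-+ 2 h z ⟨
    2 * (h + z)     ≤⟨ *-monoʳ-≤ 2 h+z≤1+n ⟩
    2 * suc n       ≡⟨ e₅ n ⟩
    n + 2 + n       ∎)
    where
    e₅ : ∀ n → 2 * suc n ≡ n + 2 + n
    e₅ = solve-∀

-- Windows

After : ∀ {n} → Fin n → Fin (InLen n) → Set
After ℓ p = toℕ ℓ < toℕ p

toℕ-winIdx : ∀ {n} (j k : Fin n) → toℕ (winIdx j k) ≡ toℕ j + toℕ k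
toℕ-winIdx j k = Finₚ.toℕ-fromℕ< _

toℕ-posIdx : ∀ {n} (ℓ : Fin n) → toℕ (posIdx ℓ) ≡ toℕ ℓ
toℕ-posIdx ℓ = Finₚ.toℕ-fromℕ< _

After-winIdx : ∀ {n} {ℓ : Fin n} (j k : Fin n) → toℕ ℓ < toℕ j + toℕ k → After ℓ (winIdx j k)
After-winIdx j k = subst (_ <_) (sym (toℕ-winIdx j k))

¬After-posIdx : ∀ {n} (ℓ : Fin n) → ¬ After ℓ (posIdx ℓ)
¬After-posIdx ℓ = <-irrefl (sym (toℕ-posIdx ℓ))

After⇒≢posIdx : ∀ {n} {ℓ : Fin n} {p} → After ℓ p → p ≢ posIdx ℓ
After⇒≢posIdx {ℓ = ℓ} ℓ<p refl = ¬After-posIdx ℓ ℓ<p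

windowTail : ∀ {n} → Fin n → Input n → List (Fin n)
windowTail {suc n} ℓ x = tabulate (λ k → x (winIdx ℓ (Fin.suc k)))

window-split : ∀ {n} (ℓ : Fin n) (x : Input n) → window x ℓ ≡ x (posIdx ℓ) ∷ windowTail ℓ x
window-split {suc n} ℓ x = cong₂ _∷_
  (cong x (Finₚ.toℕ-injective (begin
    toℕ (winIdx ℓ Fin.zero) ≡⟨ toℕ-winIdx ℓ Fin.zero ⟩
    toℕ ℓ + 0               ≡⟨ +-identityʳ (toℕ ℓ) ⟩
    toℕ ℓ                   ≡⟨ toℕ-posIdx ℓ ⟨
    toℕ (posIdx ℓ)          ∎)))
  (Listₚ.map-tabulate Fin.suc (λ k → x (winIdx ℓ k)))
  where open ≡-Reasoning

windowTail-map : ∀ {n} {x x′ : Input n} {f : Fin n → Fin n} (ℓ : Fin n) →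
            (∀ p → After ℓ p → x′ p ≡ f (x p)) → windowTail ℓ x′ ≡ map f (windowTail ℓ x)
windowTail-map {suc n} {x} {f = f} ℓ x′≡fx = trans
  (Listₚ.tabulate-cong λ k → x′≡fx _ (After-winIdx ℓ (Fin.suc k) (m<m+n (toℕ ℓ) (s≤s z≤n))))
  (sym (Listₚ.map-tabulate (λ k → x (winIdx ℓ (Fin.suc k))) f))

y-invariant : ∀ {n} (j : Fin n) → Invariant (λ x → y x j)
y-invariant j x≗x′ = cong F₀ (Listₚ.map-cong (λ k → x≗x′ (winIdx j k)) (allFin _))

y-permute-after : ∀ {n} {x x′ : Input n} (σ : Permutation′ n) {ℓ j : Fin n} →
                  (∀ p → After ℓ p → x′ p ≡ σ ⟨$⟩ʳ x p) → toℕ ℓ < toℕ j → y x′ j ≡ y x j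
y-permute-after {x = x} σ {j = j} x′≡σx ℓ<j = trans
  (cong F₀ (trans (Listₚ.map-cong (λ k → x′≡σx _ (After-winIdx j k (<-≤-trans ℓ<j (m≤m+n (toℕ j) (toℕ k)))))
                                  (allFin _))
                  (Listₚ.map-∘ (allFin _))))
  (F₀-map-permutation σ (window x j))

-- Paths and outputs

allᵇ-cong : ∀ {A : Set} {p q : A → Bool} (as : List A) →
            (∀ a → a ∈ as → p a ≡ q a) → allᵇ p as ≡ allᵇ q as
allᵇ-cong [] p≡q = refl
allᵇ-cong (a ∷ as) p≡q = cong₂ _∧_ (p≡q a (here refl)) (allᵇ-cong as (λ a′ → p≡q a′ ∘ there))

allᵇ-∈ : ∀ {A : Set} {p : A → Bool} {a} (as : List A) → allᵇ p as ≡ true → a ∈ as → p a ≡ true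
allᵇ-∈ {p = p} (a ∷ as) all-p (here refl) with p a
... | true = refl
... | false = all-p
allᵇ-∈ {p = p} (a ∷ as) all-p (there a∈as) with p a
... | true = allᵇ-∈ as all-p a∈as
... | false = contradiction all-p λ ()

allᵇ-map : ∀ {A B : Set} (p : B → Bool) (f : A → B) (as : List A) → allᵇ p (map f as) ≡ allᵇ (p ∘ f) as
allᵇ-map p f [] = refl
allᵇ-map p f (a ∷ as) = cong (p (f a) ∧_) (allᵇ-map p f as)

≡-⇔ : ∀ {A : Set} {u v w : A} → u ≡ v → (u ≡ w ⇔ v ≡ w)
≡-⇔ u≡v = mk⇔ (trans (sym u≡v)) (trans u≡v)

⌊⌋-true⇒ : ∀ {A : Set} (a? : Dec A) → ⌊ a? ⌋ ≡ true → A
⌊⌋-true⇒ (yes a) _ = a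

⌊⌋-⇔ : ∀ {A B : Set} → A ⇔ B → (a? : Dec A) (b? : Dec B) → ⌊ a? ⌋ ≡ ⌊ b? ⌋
⌊⌋-⇔ A⇔B a? b? = trans (isYes≗does a?) (trans (does-⇔ A⇔B a? b?) (sym (isYes≗does b?)))

follows-cong : ∀ {n} {x x′ : Input n} (π : Path n) →
               (∀ s → s ∈ π → (x (query s) ≡ answer s ⇔ x′ (query s) ≡ answer s)) →
               follows x π ≡ follows x′ π
follows-cong {x = x} {x′} π x⇔x′ =
  allᵇ-cong π λ s s∈π →
    ⌊⌋-⇔ (x⇔x′ s s∈π) (x (query s) Finₚ.≟ answer s) (x′ (query s) Finₚ.≟ answer s)

follows-invariant : ∀ {n} (π : Path n) → Invariant (λ x → follows x π)
follows-invariant π x≗x′ = follows-cong π λ s _ → ≡-⇔ (x≗x′ (query s))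

follows⇒answer : ∀ {n} {x : Input n} {π s} → follows x π ≡ true → s ∈ π → x (query s) ≡ answer s
follows⇒answer {x = x} {π} {s} x-follows s∈π =
  ⌊⌋-true⇒ (x (query s) Finₚ.≟ answer s) (allᵇ-∈ π x-follows s∈π)

matches-cong : ∀ {n r} {x x′ : Input n} (is : Vector (Fin n) r) zs →
               (∀ k → y x (is k) ≡ y x′ (is k)) → matches x is zs ≡ matches x′ is zs
matches-cong is zs yx≡yx′ = allᵇ-cong (allFin _) λ k _ → cong (λ t → ⌊ t ℕ.≟ zs k ⌋) (yx≡yx′ k)

matches-suc : ∀ {n r} (x : Input n) (is : Vector (Fin n) (suc r)) zs →
              matches x is zs ≡ ⌊ y x (is Fin.zero) ℕ.≟ zs Fin.zero ⌋ ∧ matches x (is ∘ Fin.suc) (zs ∘ Fin.suc)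
matches-suc {r = r} x is zs = cong (⌊ y x (is Fin.zero) ℕ.≟ zs Fin.zero ⌋ ∧_) (begin
  allᵇ p (tabulate Fin.suc)        ≡⟨ cong (allᵇ p) (Listₚ.map-tabulate (λ k → k) Fin.suc) ⟨
  allᵇ p (map Fin.suc (allFin r))  ≡⟨ allᵇ-map p Fin.suc (allFin r) ⟩
  allᵇ (p ∘ Fin.suc) (allFin r)    ∎)
  where
  open ≡-Reasoning
  p : Fin (suc r) → Bool
  p k = ⌊ y x (is k) ℕ.≟ zs k ⌋

matches⇒≡ : ∀ {n r} {x : Input n} (is : Vector (Fin n) r) zs →
            matches x is zs ≡ true → ∀ k → y x (is k) ≡ zs k
matches⇒≡ {x = x} is zs x-matches k =
  ⌊⌋-true⇒ (y x (is k) ℕ.≟ zs k) (allᵇ-∈ (allFin _) x-matches (∈-allFin k))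

InRange : ℕ → ℕ → Set
InRange n z = n ≤ 2 * z × 20 * z ≤ 17 * n

eventE⇒InRange : ∀ {n} {x : Input n} → eventE x ≡ true → ∀ i → InRange n (y x i)
eventE⇒InRange {n} {x} x-event i =
  ⌊⌋-true⇒ (n ℕ.≤? 2 * y x i) (∧-conicalˡ _ _ at-i) ,
  ⌊⌋-true⇒ (20 * y x i ℕ.≤? 17 * n) (∧-conicalʳ _ _ at-i)
  where at-i = allᵇ-∈ (allFin n) x-event (∈-allFin i)

-- Resampling one output

resetAt : ∀ {n} → Fin n → Fin n → Input n → Input n
resetAt ℓ b x = updateAt x (posIdx ℓ) (const b)

y-resetAt : ∀ {n} (ℓ b : Fin n) (x : Input n) → y (resetAt ℓ b x) ℓ ≡ F₀ (b ∷ windowTail ℓ x)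
y-resetAt ℓ b x = cong F₀ (begin
  window (resetAt ℓ b x) ℓ
    ≡⟨ window-split ℓ (resetAt ℓ b x) ⟩
  resetAt ℓ b x (posIdx ℓ) ∷ windowTail ℓ (resetAt ℓ b x)
    ≡⟨ cong₂ _∷_ (updateAt-updates (posIdx ℓ) x) tail-unchanged ⟩
  b ∷ windowTail ℓ x ∎)
  where
  open ≡-Reasoning
  tail-unchanged : windowTail ℓ (resetAt ℓ b x) ≡ windowTail ℓ x
  tail-unchanged = trans (windowTail-map ℓ λ p ℓ<p → updateAt-minimal p (posIdx ℓ) x (After⇒≢posIdx ℓ<p))
                         (Listₚ.map-id (windowTail ℓ x))

y-resetAt-after : ∀ {n} {ℓ j : Fin n} b (x : Input n) → toℕ ℓ < toℕ j → y (resetAt ℓ b x) j ≡ y x j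
y-resetAt-after {ℓ = ℓ} b x =
  y-permute-after {x = x} {resetAt ℓ b x} Perm.id λ p ℓ<p → updateAt-minimal p (posIdx ℓ) x (After⇒≢posIdx ℓ<p)

transpose-matchʳ : ∀ {n} (a b : Fin n) → PC.transpose a b b ≡ a
transpose-matchʳ a b with b Finₚ.≟ a
... | yes b≡a = b≡a
... | no _ rewrite dec-true (b Finₚ.≟ b) refl = refl

transpose-fixes : ∀ {n} {a b c : Fin n} → c ≢ a → c ≢ b → PC.transpose a b c ≡ c
transpose-fixes {a = a} {b} {c} c≢a c≢b rewrite dec-false (c Finₚ.≟ a) c≢a | dec-false (c Finₚ.≟ b) c≢b = refl

permute-fixed-⇔ : ∀ {n} (σ : Permutation′ n) {c d} → σ ⟨$⟩ʳ d ≡ d → (σ ⟨$⟩ʳ c ≡ d ⇔ c ≡ d)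
permute-fixed-⇔ σ {c} {d} σd≡d = mk⇔ σc≡d⇒c≡d (λ c≡d → trans (cong (σ ⟨$⟩ʳ_) c≡d) σd≡d)
  where
  σc≡d⇒c≡d : σ ⟨$⟩ʳ c ≡ d → c ≡ d
  σc≡d⇒c≡d σc≡d = begin
    c                     ≡⟨ Perm.inverseˡ σ ⟨
    σ ⟨$⟩ˡ (σ ⟨$⟩ʳ c)     ≡⟨ cong (σ ⟨$⟩ˡ_) (trans σc≡d (sym σd≡d)) ⟩
    σ ⟨$⟩ˡ (σ ⟨$⟩ʳ d)     ≡⟨ Perm.inverseˡ σ ⟩
    d                     ∎
    where open ≡-Reasoning

swapAfter : ∀ {n} → Fin n → Fin n → Fin n → Fin (InLen n) → Permutation′ n
swapAfter ℓ a b p = if ⌊ toℕ ℓ ℕ.<? toℕ p ⌋ then Perm.transpose a b else Perm.id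

swapAfter-After : ∀ {n} {ℓ a b : Fin n} {p} → After ℓ p → swapAfter ℓ a b p ≡ Perm.transpose a b
swapAfter-After {ℓ = ℓ} {p = p} ℓ<p with toℕ ℓ ℕ.<? toℕ p
... | yes _ = refl
... | no ℓ≮p = contradiction ℓ<p ℓ≮p

swapAfter-¬After : ∀ {n} {ℓ a b : Fin n} {p} → ¬ After ℓ p → swapAfter ℓ a b p ≡ Perm.id
swapAfter-¬After {ℓ = ℓ} {p = p} ℓ≮p with toℕ ℓ ℕ.<? toℕ p
... | yes ℓ<p = contradiction ℓ<p ℓ≮p
... | no _ = refl

swapAfter-fixes : ∀ {n} {ℓ a b d : Fin n} p → d ≢ a → d ≢ b → swapAfter ℓ a b p ⟨$⟩ʳ d ≡ d
swapAfter-fixes {ℓ = ℓ} p d≢a d≢b with toℕ ℓ ℕ.<? toℕ p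
... | yes _ = transpose-fixes d≢a d≢b
... | no _ = refl

relabelAfter : ∀ {n} → Fin n → Fin n → Fin n → Input n → Input n
relabelAfter ℓ a b x p = swapAfter ℓ a b p ⟨$⟩ʳ x p

relabelAfter-After : ∀ {n} {ℓ : Fin n} a b (x : Input n) p → After ℓ p →
                     relabelAfter ℓ a b x p ≡ Perm.transpose a b ⟨$⟩ʳ x p
relabelAfter-After a b x p ℓ<p = cong (_⟨$⟩ʳ x p) (swapAfter-After {a = a} {b} ℓ<p)

y-relabelAfter : ∀ {n} (ℓ a b : Fin n) (x : Input n) → x (posIdx ℓ) ≡ a →
                 y (relabelAfter ℓ a b x) ℓ ≡ F₀ (b ∷ windowTail ℓ x)
y-relabelAfter ℓ a b x xℓ≡a = begin
  F₀ (window (relabelAfter ℓ a b x) ℓ)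
    ≡⟨ cong F₀ (window-split ℓ (relabelAfter ℓ a b x)) ⟩
  F₀ (relabelAfter ℓ a b x (posIdx ℓ) ∷ windowTail ℓ (relabelAfter ℓ a b x))
    ≡⟨ cong F₀ (cong₂ _∷_ head≡ (windowTail-map ℓ (relabelAfter-After a b x))) ⟩
  F₀ (map (σ ⟨$⟩ʳ_) (b ∷ windowTail ℓ x))
    ≡⟨ F₀-map-permutation σ (b ∷ windowTail ℓ x) ⟩
  F₀ (b ∷ windowTail ℓ x) ∎
  where
  open ≡-Reasoning
  σ = Perm.transpose a b
  head≡ : relabelAfter ℓ a b x (posIdx ℓ) ≡ σ ⟨$⟩ʳ b
  head≡ = begin
    relabelAfter ℓ a b x (posIdx ℓ)
      ≡⟨ cong (_⟨$⟩ʳ x (posIdx ℓ)) (swapAfter-¬After {a = a} {b} (¬After-posIdx ℓ)) ⟩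
    x (posIdx ℓ)                    ≡⟨ xℓ≡a ⟩
    a                               ≡⟨ transpose-matchʳ a b ⟨
    σ ⟨$⟩ʳ b                        ∎

y-relabelAfter-after : ∀ {n} {ℓ j : Fin n} a b (x : Input n) → toℕ ℓ < toℕ j →
                       y (relabelAfter ℓ a b x) j ≡ y x j
y-relabelAfter-after {ℓ = ℓ} a b x =
  y-permute-after {x = x} {relabelAfter ℓ a b x} (Perm.transpose a b) (relabelAfter-After a b x)

relabelAfter-follows : ∀ {n} (π : Path n) (ℓ : Fin n) → PiUnique π (posIdx ℓ) →
                       ∀ {s₀} → s₀ ∈ π → query s₀ ≡ posIdx ℓ →
                       ∀ {b} → (∀ s → s ∈ π → query s ≢ posIdx ℓ → answer s ≢ b) →
                       ∀ x → follows (relabelAfter ℓ (answer s₀) b x) π ≡ follows x π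
relabelAfter-follows π ℓ unique {s₀} s₀∈π s₀↦ℓ {b} b≢others x = follows-cong π same-verdict
  where
  a = answer s₀
  same-verdict : ∀ s → s ∈ π → (relabelAfter ℓ a b x (query s) ≡ answer s ⇔ x (query s) ≡ answer s)
  same-verdict s s∈π with query s Finₚ.≟ posIdx ℓ
  ... | yes s↦ℓ = ≡-⇔ (cong (_⟨$⟩ʳ x (query s)) (swapAfter-¬After {a = a} {b}
                    (subst (¬_ ∘ After ℓ) (sym s↦ℓ) (¬After-posIdx ℓ))))
  ... | no s↦̸ℓ = permute-fixed-⇔ (swapAfter ℓ a b (query s))
                    (swapAfter-fixes (query s) (unique s₀ s₀∈π s₀↦ℓ s s∈π s↦̸ℓ ∘ sym) (b≢others s s∈π s↦̸ℓ))

record Resampling {n} (ℓ : Fin n) (G : Input n → Bool) : Set where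
  field
    γ         : Fin n → Input n → Input n
    β         : Fin n → ℕ
    β≤1       : ∀ b → β b ≤ 1
    heavy     : 9 * n ≤ 10 * sum β
    average   : ∀ {W} → Invariant W →
                ∑[ b < n ] (β b * total (InLen n) n (W ∘ γ b)) ≡ sum β * total (InLen n) n W
    keeps     : ∀ b x → β b * 𝟙 (G (γ b x)) ≡ β b * 𝟙 (G x)
    resamples : ∀ x → G x ≡ true → ∀ b → y (γ b x) ℓ ≡ F₀ (b ∷ windowTail ℓ x)

resampling-bound : ∀ {n} {ℓ : Fin n} {G : Input n → Bool} z → 3 ≤ n → n ≤ 2 * z → 20 * z ≤ 17 * n →
                   Invariant G → Resampling ℓ G →
                   18 * count (InLen n) n (λ x → G x ∧ ⌊ y x ℓ ℕ.≟ z ⌋) ≤ 17 * count (InLen n) n G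
resampling-bound {n} {ℓ} {G} z 3≤n n≤2z 20z≤17n G-inv ρ =
  averaging 17 18 G (λ x → ⌊ y x ℓ ℕ.≟ z ⌋) γ β β-pos average G-inv
            (cong (λ t → ⌊ t ℕ.≟ z ⌋) ∘ y-invariant ℓ) keeps bound
  where
  open Resampling ρ
  β-pos : 0 < sum β
  β-pos with sum β | heavy
  ... | zero  | 9n≤0 = contradiction (≤-trans (*-monoʳ-≤ 9 (≤-trans (s≤s z≤n) 3≤n)) 9n≤0) λ ()
  ... | suc _ | _ = s≤s z≤n
  bound : ∀ x → G x ≡ true → 18 * ∑[ b < n ] (β b * 𝟙 ⌊ y (γ b x) ℓ ℕ.≟ z ⌋) ≤ 17 * sum β
  bound x Gx = ≤-trans (*-monoʳ-≤ 18 (sum-mono-≤ hit≤extension))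
    (18h≤17m {m = sum β} 3≤n heavy n≤2z 20z≤17n (#extensions-bound (windowTail ℓ x) z))
    where
    hit≤extension : ∀ b → β b * 𝟙 ⌊ y (γ b x) ℓ ℕ.≟ z ⌋ ≤ 𝟙 ⌊ F₀ (b ∷ windowTail ℓ x) ℕ.≟ z ⌋
    hit≤extension b rewrite resamples x Gx b = ≤-trans (*-monoˡ-≤ _ (β≤1 b)) (≤-reflexive (+-identityʳ _))

DeterminedByOutputsAfter : ∀ {n} → Fin n → (Input n → Bool) → Set
DeterminedByOutputsAfter ℓ H = ∀ x x′ → (∀ j → toℕ ℓ < toℕ j → y x j ≡ y x′ j) → H x ≡ H x′

resetting : ∀ {n} (π : Path n) (ℓ : Fin n) {H : Input n → Bool} → DeterminedByOutputsAfter ℓ H →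
            (∀ s → s ∈ π → query s ≢ posIdx ℓ) → Resampling ℓ (λ x → follows x π ∧ H x)
resetting {n} π ℓ H-det unqueried = record
  { γ = resetAt ℓ
  ; β = const 1
  ; β≤1 = λ _ → ≤-refl
  ; heavy = ≤-trans (*-monoˡ-≤ n (n≤1+n 9)) (≤-reflexive (cong (10 *_) (sym #all)))
  ; average = λ {W} W-inv → begin
      ∑[ b < n ] (1 * total N n (W ∘ resetAt ℓ b))
        ≡⟨ sum-cong-≗ (λ b → *-identityˡ (total N n (W ∘ resetAt ℓ b))) ⟩
      ∑[ b < n ] total N n (W ∘ resetAt ℓ b)  ≡⟨ total-update N n (posIdx ℓ) W-inv ⟩
      n * total N n W                          ≡⟨ cong (_* total N n W) #all ⟨
      sum {n} (const 1) * total N n W          ∎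
  ; keeps = λ b x → cong (λ t → 1 * 𝟙 t) (cong₂ _∧_
      (follows-cong π λ s s∈π → ≡-⇔ (updateAt-minimal (query s) (posIdx ℓ) x (unqueried s s∈π)))
      (H-det (resetAt ℓ b x) x λ j → y-resetAt-after b x))
  ; resamples = λ x _ b → y-resetAt ℓ b x
  }
  where
  open ≡-Reasoning
  N = InLen n
  #all : sum {n} (const 1) ≡ n
  #all = trans (sum-const n 1) (*-identityʳ n)

10a≤n⇒9n≤10m : ∀ {n a m} → a + m ≡ n → 10 * a ≤ n → 9 * n ≤ 10 * m
10a≤n⇒9n≤10m {n} {a} {m} a+m≡n 10a≤n = +-cancelʳ-≤ n (9 * n) (10 * m) (begin
  9 * n + n         ≡⟨ e n ⟩
  10 * n            ≡⟨ cong (10 *_) a+m≡n ⟨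
  10 * (a + m)      ≡⟨ *-distribˡ-+ 10 a m ⟩
  10 * a + 10 * m   ≤⟨ +-monoˡ-≤ (10 * m) 10a≤n ⟩
  n + 10 * m        ≡⟨ +-comm n (10 * m) ⟩
  10 * m + n        ∎)
  where
  open ≤-Reasoning
  e : ∀ n → 9 * n + n ≡ 10 * n
  e = solve-∀

relabelling : ∀ {n} (π : Path n) (ℓ : Fin n) {H : Input n → Bool} → DeterminedByOutputsAfter ℓ H →
              PiUnique π (posIdx ℓ) → 10 * length π ≤ n →
              ∀ {s₀} → s₀ ∈ π → query s₀ ≡ posIdx ℓ → Resampling ℓ (λ x → follows x π ∧ H x)
relabelling {n} π ℓ {H} H-det unique 10π≤n {s₀} s₀∈π s₀↦ℓ = record
  { γ = relabelAfter ℓ a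
  ; β = β
  ; β≤1 = λ b → 𝟙≤1 (does (b ∉? A′))
  ; heavy = 10a≤n⇒9n≤10m {a = #symbols A′} (sum-𝟙+sum-𝟙-not (λ b → does (b ∈? A′)))
              (≤-trans (*-monoʳ-≤ 10 #A′≤π) 10π≤n)
  ; average = λ {W} W-inv → begin-equality
      ∑[ b < n ] (β b * total N n (W ∘ relabelAfter ℓ a b))
        ≡⟨ sum-cong-≗ (λ b → cong (β b *_) (total-permute N n (swapAfter ℓ a b) W-inv)) ⟩
      ∑[ b < n ] (β b * total N n W)
        ≡⟨ *-distribʳ-sum (total N n W) β ⟨
      sum β * total N n W ∎
  ; keeps = keeps
  ; resamples = λ x G b → y-relabelAfter ℓ a b x
      (subst (λ p → x p ≡ a) s₀↦ℓ (follows⇒answer (∧-conicalˡ _ (H x) G) s₀∈π))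
  }
  where
  open ≤-Reasoning
  N = InLen n
  a = answer s₀
  others = filter (λ s → ¬? (query s Finₚ.≟ posIdx ℓ)) π
  A′ = map answer others
  β : Fin n → ℕ
  β b = 𝟙 (does (b ∉? A′))
  #A′≤π : ∑[ b < n ] 𝟙 (does (b ∈? A′)) ≤ length π
  #A′≤π = begin
    #symbols A′      ≡⟨ F₀≡#symbols A′ ⟨
    F₀ A′            ≤⟨ Listₚ.length-deduplicate Finₚ._≟_ A′ ⟩
    length A′        ≡⟨ Listₚ.length-map answer others ⟩
    length others    ≤⟨ Listₚ.length-filter (λ s → ¬? (query s Finₚ.≟ posIdx ℓ)) π ⟩
    length π         ∎
  keeps : ∀ b x → β b * 𝟙 (follows (relabelAfter ℓ a b x) π ∧ H (relabelAfter ℓ a b x)) ≡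
                  β b * 𝟙 (follows x π ∧ H x)
  keeps b x with b ∈? A′
  ... | yes _ = refl
  ... | no b∉A′ = cong (λ t → 1 * 𝟙 t) (cong₂ _∧_ (relabelAfter-follows π ℓ unique s₀∈π s₀↦ℓ b≢others x)
                   (H-det (relabelAfter ℓ a b x) x λ j → y-relabelAfter-after a b x))
    where
    b≢others : ∀ s → s ∈ π → query s ≢ posIdx ℓ → answer s ≢ b
    b≢others s s∈π s↦̸ℓ refl = b∉A′ (∈-map⁺ answer (∈-filter⁺ (λ s → ¬? (query s Finₚ.≟ posIdx ℓ)) s∈π s↦̸ℓ))

peel : ∀ {n} (π : Path n) → 3 ≤ n → 10 * length π ≤ n →
       (ℓ : Fin n) (z : ℕ) → n ≤ 2 * z → 20 * z ≤ 17 * n → PiUnique π (posIdx ℓ) →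
       {H : Input n → Bool} → DeterminedByOutputsAfter ℓ H →
       18 * count (InLen n) n (λ x → follows x π ∧ (⌊ y x ℓ ℕ.≟ z ⌋ ∧ H x))
         ≤ 17 * count (InLen n) n (λ x → follows x π ∧ H x)
peel {n} π 3≤n 10π≤n ℓ z n≤2z 20z≤17n unique {H} H-det =
  subst (λ c → 18 * c ≤ _) (count-cong (InLen n) n reorder)
    (resampling-bound z 3≤n n≤2z 20z≤17n G-inv ρ)
  where
  G-inv : Invariant (λ x → follows x π ∧ H x)
  G-inv {x} {x′} x≗x′ = cong₂ _∧_ (follows-invariant π x≗x′) (H-det x x′ λ j _ → y-invariant j x≗x′)
  reorder : ∀ x → (follows x π ∧ H x) ∧ ⌊ y x ℓ ℕ.≟ z ⌋ ≡ follows x π ∧ (⌊ y x ℓ ℕ.≟ z ⌋ ∧ H x)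
  reorder x = trans (∧-assoc (follows x π) (H x) _) (cong (follows x π ∧_) (∧-comm (H x) _))
  ρ : Resampling ℓ (λ x → follows x π ∧ H x)
  ρ with any? (λ s → query s Finₚ.≟ posIdx ℓ) π
  ... | yes queried = let s₀ , s₀∈π , s₀↦ℓ = find queried in
                      relabelling π ℓ H-det unique 10π≤n s₀∈π s₀↦ℓ
  ... | no unqueried = resetting π ℓ H-det λ s s∈π s↦ℓ → unqueried (lose s∈π s↦ℓ)

-- All outputs

outputs-bound : ∀ {n} (π : Path n) → 3 ≤ n → 10 * length π ≤ n →
                ∀ {r} (is : Vector (Fin n) r) zs → (∀ k l → k Fin.< l → is k Fin.< is l) →
                (∀ k → PiUnique π (posIdx (is k))) → (∀ k → InRange n (zs k)) →
                18 ^ r * count (InLen n) n (λ x → follows x π ∧ matches x is zs)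
                  ≤ 17 ^ r * count (InLen n) n (λ x → follows x π)
outputs-bound {n} π 3≤n 10π≤n {zero} is zs _ _ _ =
  ≤-reflexive (cong (1 *_) (count-cong (InLen n) n λ x → ∧-identityʳ (follows x π)))
outputs-bound {n} π 3≤n 10π≤n {suc r} is zs increasing unique in-range = begin
  18 ^ suc r * count N n (λ x → follows x π ∧ matches x is zs)
    ≡⟨ cong (18 ^ suc r *_) (count-cong N n λ x → cong (follows x π ∧_) (matches-suc x is zs)) ⟩
  18 ^ suc r * count N n (λ x → follows x π ∧ (⌊ y x (is Fin.zero) ℕ.≟ zs Fin.zero ⌋ ∧ H x))
    ≡⟨ swap (18 ^ r) 18 _ ⟩
  18 ^ r * (18 * count N n (λ x → follows x π ∧ (⌊ y x (is Fin.zero) ℕ.≟ zs Fin.zero ⌋ ∧ H x)))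
    ≤⟨ *-monoʳ-≤ (18 ^ r) (peel π 3≤n 10π≤n (is Fin.zero) (zs Fin.zero) (proj₁ (in-range Fin.zero))
                    (proj₂ (in-range Fin.zero)) (unique Fin.zero) H-det) ⟩
  18 ^ r * (17 * count N n (λ x → follows x π ∧ H x))
    ≡⟨ swap′ (18 ^ r) 17 _ ⟩
  17 * (18 ^ r * count N n (λ x → follows x π ∧ H x))
    ≤⟨ *-monoʳ-≤ 17 (outputs-bound π 3≤n 10π≤n (is ∘ Fin.suc) (zs ∘ Fin.suc)
                       (λ k l k<l → increasing (Fin.suc k) (Fin.suc l) (s≤s k<l))
                       (unique ∘ Fin.suc) (in-range ∘ Fin.suc)) ⟩
  17 * (17 ^ r * count N n (λ x → follows x π))
    ≡⟨ *-assoc 17 (17 ^ r) _ ⟨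
  17 ^ suc r * count N n (λ x → follows x π) ∎
  where
  open ≤-Reasoning
  N = InLen n
  H : Input n → Bool
  H x = matches x (is ∘ Fin.suc) (zs ∘ Fin.suc)
  H-det : DeterminedByOutputsAfter (is Fin.zero) H
  H-det x x′ y≡ = matches-cong {x = x} {x′} (is ∘ Fin.suc) (zs ∘ Fin.suc) λ k →
    y≡ (is (Fin.suc k)) (increasing Fin.zero (Fin.suc k) (s≤s z≤n))
  swap : ∀ a b c → b * a * c ≡ a * (b * c)
  swap = solve-∀
  swap′ : ∀ a b c → a * (b * c) ≡ b * (a * c)
  swap′ = solve-∀

outputs∧event-bound : ∀ {n} (π : Path n) → 3 ≤ n → 10 * length π ≤ n →
  ∀ {r} (is : Vector (Fin n) r) zs →
  (∀ k l → k Fin.< l → is k Fin.< is l) → (∀ k → PiUnique π (posIdx (is k))) →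
  18 ^ r * count (InLen n) n (λ x → follows x π ∧ (matches x is zs ∧ eventE x))
    ≤ 17 ^ r * count (InLen n) n (λ x → follows x π)
outputs∧event-bound {n} π 3≤n 10π≤n {r} is zs increasing unique
  with Finₚ.all? (λ k → (n ℕ.≤? 2 * zs k) ×-dec (20 * zs k ℕ.≤? 17 * n))
... | yes in-range = ≤-trans (*-monoʳ-≤ (18 ^ r) (count-mono (InLen n) n drop-event))
                             (outputs-bound π 3≤n 10π≤n is zs increasing unique in-range)
  where
  drop-event : ∀ x → follows x π ∧ (matches x is zs ∧ eventE x) ≡ true → follows x π ∧ matches x is zs ≡ true
  drop-event x rewrite sym (∧-assoc (follows x π) (matches x is zs) (eventE x)) = ∧-conicalˡ _ _
... | no out-of-range =
  ≤-trans (≤-reflexive (trans (cong (18 ^ r *_) (n≤0⇒n≡0 impossible)) (*-zeroʳ (18 ^ r)))) z≤n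
  where
  k = proj₁ (Finₚ.¬∀⟶∃¬ r _ (λ k → (n ℕ.≤? 2 * zs k) ×-dec (20 * zs k ℕ.≤? 17 * n)) out-of-range)
  zₖ-out = proj₂ (Finₚ.¬∀⟶∃¬ r _ (λ k → (n ℕ.≤? 2 * zs k) ×-dec (20 * zs k ℕ.≤? 17 * n)) out-of-range)
  never : ∀ x → follows x π ∧ (matches x is zs ∧ eventE x) ≡ true → false ≡ true
  never x both = contradiction
    (subst (InRange n) (matches⇒≡ {x = x} is zs (∧-conicalˡ _ _ rest) k)
                       (eventE⇒InRange {x = x} (∧-conicalʳ _ _ rest) (is k)))
    zₖ-out
    where
    rest : matches x is zs ∧ eventE x ≡ true
    rest = ∧-conicalʳ (follows x π) _ both
  impossible : count (InLen n) n (λ x → follows x π ∧ (matches x is zs ∧ eventE x)) ≤ 0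
  impossible = ≤-trans (count-mono (InLen n) n never)
                       (≤-reflexive (trans (count≡total (InLen n) n (const false)) (total-zero (InLen n) n)))

lemma2p5 : (n r q : ℕ) → 1 ≤ r → 10 * q ≤ n →
    (π : Path n) → length π ≤ q →
    (is : Vector (Fin n) r) → (zs : Vector ℕ r) →
    (∀ k l → k Fin.< l → is k Fin.< is l) →
    (∀ k → PiUnique π (posIdx (is k))) →
    (∀ k → (is k , zs k) ∈ Outputs π) →
    18 ^ r * count (InLen n) n (λ x → follows x π ∧ (matches x is zs ∧ eventE x))
      ≤ 17 ^ r * count (InLen n) n (λ x → follows x π)
lemma2p5 n zero q () _ _ _ _ _ _ _ _
lemma2p5 zero (suc r) q _ _ _ _ is _ _ _ _ with is Fin.zero
... | ()
lemma2p5 (suc n) (suc r) q _ _ [] _ _ _ _ _ output with output Fin.zero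
... | ()
lemma2p5 n (suc r) q _ 10q≤n π@(_ ∷ _) π≤q is zs increasing unique _ =
  outputs∧event-bound π 3≤n 10π≤n is zs increasing unique
  where
  10π≤n : 10 * length π ≤ n
  10π≤n = ≤-trans (*-monoʳ-≤ 10 π≤q) 10q≤n
  3≤n : 3 ≤ n
  3≤n = ≤-trans (s≤s (s≤s (s≤s z≤n))) (≤-trans (*-monoʳ-≤ 10 (s≤s z≤n)) 10π≤n)
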